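{- For every integer $M \geq 1$, the number of partitions into distinct parts with perimeter $M$ equals the number of partitions into odd parts with perimeter $M$, and both numbers equal the Fibonacci number $F_M$.
   Context: A partition $\lambda = (\lambda_1, \ldots, \lambda_\ell)$ is a finite weakly decreasing sequence of positive integers. A partition into distinct parts has $\lambda_1 > \cdots > \lambda_\ell$; a partition into odd parts has all $\lambda_i$ odd. The perimeter of a nonempty partition is $\lambda_1 + \ell - 1$ (the largest part plus the number of parts minus $1$, equivalently the maximum hook length in its Young diagram); the empty partition has perimeter $0$. The Fibonacci numbers are defined by $F_0 = 0$, $F_1 = 1$, $F_{n} = F_{n-1} + F_{n-2}$. -}

module Defs where

open import Data.Nat using (ℕ; zero; suc; _+_; _∸_; _≥_; _>_; _≤_)
open import Data.List using (List; []; _∷_; length)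
open import Data.List.Relation.Unary.All using (All)
open import Data.List.Relation.Unary.Linked using (Linked)
open import Data.Nat.DivMod using (_%_)
open import Data.Product using (Σ; _×_)
open import Data.Fin using (Fin)
open import Function.Bundles using (_↔_)
open import Relation.Binary.PropositionalEquality using (_≡_)

fib : ℕ → ℕ
fib zero = 0
fib (suc zero) = 1
fib (suc (suc n)) = fib (suc n) + fib n

IsPartition : List ℕ → Set
IsPartition l = All (λ x → x ≥ 1) l × Linked _≥_ l

IsDistinctPartition : List ℕ → Set
IsDistinctPartition l = IsPartition l × Linked _>_ l

IsOddPartition : List ℕ → Set
IsOddPartition l = IsPartition l × All (λ x → x % 2 ≡ 1) l

perimeter : List ℕ → ℕ
perimeter [] = 0
perimeter (x ∷ xs) = x + length (x ∷ xs) ∸ 1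

DistinctWithPerimeter : ℕ → Set
DistinctWithPerimeter M = Σ (List ℕ) (λ l → IsDistinctPartition l × perimeter l ≡ M)

OddWithPerimeter : ℕ → Set
OddWithPerimeter M = Σ (List ℕ) (λ l → IsOddPartition l × perimeter l ≡ M)

HasCard : Set → ℕ → Set
HasCard A n = Fin n ↔ A

module Submission where

-- Both families satisfy the Fibonacci recurrence, by a case split on the
-- largest part λ₁ of a partition of perimeter M + 2.  Distinct parts: if
-- λ₁ = λ₂ + 1, deleting λ₁ leaves perimeter M; otherwise lowering λ₁ by one
-- leaves a distinct partition of perimeter M + 1.  Odd parts: if λ₁ = λ₂,
-- deleting λ₁ leaves perimeter M + 1; otherwise λ₁ ≥ λ₂ + 2 by parity and
-- lowering λ₁ by two leaves perimeter M.  For M = 1, 2 there is exactly one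
-- partition of each kind.

open import Defs
open import Data.Nat using (ℕ; zero; suc; _+_; _∸_; _≥_; _>_; _≤_; _<_; z≤n; s≤s)
open import Data.Nat.Properties
open import Data.Nat.DivMod using (_%_; [m+n]%n≡m%n)
open import Data.List using (List; []; _∷_; length)
open import Data.List.Relation.Unary.All as All using (All; []; _∷_)
open import Data.List.Relation.Unary.Linked as Linked using (Linked; []; [-]; _∷_)
open import Data.Product using (Σ; _×_; _,_; proj₁)
open import Data.Sum using (_⊎_; inj₁; inj₂; [_,_])
open import Data.Sum.Algebra using (⊎-cong)
open import Data.Empty using (⊥-elim)
open import Data.Fin using (Fin)
open import Data.Fin.Properties using (+↔⊎)
open import Function using (_∘_)
open import Function.Bundles using (_↔_; mk↔ₛ′)
open import Function.Properties.Inverse using (↔-trans)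
open import Relation.Nullary using (¬_; yes; no)
open import Relation.Unary using (Irrelevant)
open import Relation.Binary.PropositionalEquality using (_≡_; _≢_; refl; sym; trans; cong; cong₂)

HasCard-1 : {A : Set} (a : A) → (∀ b → a ≡ b) → HasCard A 1
HasCard-1 a a≡ = mk↔ₛ′ (λ _ → a) (λ _ → Fin.zero) a≡ (λ { Fin.zero → refl ; (Fin.suc ()) })

module _ (A : ℕ → Set) (A₁ : HasCard (A 1) 1) (A₂ : HasCard (A 2) 1)
         (recurrence : ∀ m → (A (2 + m) ⊎ A (1 + m)) ↔ A (3 + m)) where

  HasCard-fib : ∀ m → HasCard (A (suc m)) (fib (suc m))
  HasCard-fib zero          = A₁
  HasCard-fib (suc zero)    = A₂
  HasCard-fib (suc (suc m)) =
    ↔-trans +↔⊎ (↔-trans (⊎-cong (HasCard-fib (suc m)) (HasCard-fib m)) (recurrence m))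

proj₁-injective : {A : Set} {P : A → Set} → Irrelevant P →
                  {u v : Σ A P} → proj₁ u ≡ proj₁ v → u ≡ v
proj₁-injective irr {a , p} {.a , q} refl = cong (a ,_) (irr p q)

Linked-replaceHead : {A : Set} {R : A → A → Set} {x y : A} {xs : List A} →
                     (∀ {z} → R x z → R y z) → Linked R (x ∷ xs) → Linked R (y ∷ xs)
Linked-replaceHead f [-]        = [-]
Linked-replaceHead f (r ∷ rxs) = f r ∷ rxs

Odd : ℕ → Set
Odd n = n % 2 ≡ 1

%2-suc-suc : ∀ n → suc (suc n) % 2 ≡ n % 2
%2-suc-suc n = trans (cong (_% 2) (+-comm 2 n)) ([m+n]%n≡m%n n 2)

odd⇒positive : ∀ {n} → Odd n → n ≥ 1
odd⇒positive {zero} ()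
odd⇒positive {suc n} _ = s≤s z≤n

odd⇒suc-¬odd : ∀ n → Odd n → ¬ Odd (suc n)
odd⇒suc-¬odd (suc zero)    _  ()
odd⇒suc-¬odd (suc (suc n)) on osn =
  odd⇒suc-¬odd n (trans (sym (%2-suc-suc n)) on) (trans (sym (%2-suc-suc (suc n))) osn)

odd-gap : ∀ {x y} → Odd x → Odd y → y < x → 2 + y ≤ x
odd-gap {x} {y} ox oy y<x with suc y ≟ x
... | yes refl = ⊥-elim (odd⇒suc-¬odd y oy ox)
... | no sy≢x  = ≤∧≢⇒< y<x sy≢x

odd-∸2 : ∀ {x} → 2 ≤ x → Odd x → Odd (x ∸ 2)
odd-∸2 {suc zero}    (s≤s ()) _
odd-∸2 {suc (suc x)} _ ox = trans (sym (%2-suc-suc x)) ox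

isPartition-irrelevant : Irrelevant IsPartition
isPartition-irrelevant (pos , dec) (pos′ , dec′) =
  cong₂ _,_ (All.irrelevant ≤-irrelevant pos pos′) (Linked.irrelevant ≤-irrelevant dec dec′)

DistinctWithPerimeter-≡ : ∀ {M} {u v : DistinctWithPerimeter M} → proj₁ u ≡ proj₁ v → u ≡ v
DistinctWithPerimeter-≡ = proj₁-injective λ ((p , d) , e) ((p′ , d′) , e′) →
  cong₂ _,_ (cong₂ _,_ (isPartition-irrelevant p p′) (Linked.irrelevant ≤-irrelevant d d′))
            (≡-irrelevant e e′)

OddWithPerimeter-≡ : ∀ {M} {u v : OddWithPerimeter M} → proj₁ u ≡ proj₁ v → u ≡ v
OddWithPerimeter-≡ = proj₁-injective λ ((p , o) , e) ((p′ , o′) , e′) →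
  cong₂ _,_ (cong₂ _,_ (isPartition-irrelevant p p′) (All.irrelevant ≡-irrelevant o o′))
            (≡-irrelevant e e′)

perimeter-∷ : ∀ x xs → perimeter (x ∷ xs) ≡ x + length xs
perimeter-∷ x xs = cong (_∸ 1) (+-suc x (length xs))

perimeter-∷⁻ : ∀ {M} x xs → perimeter (x ∷ xs) ≡ M → x + length xs ≡ M
perimeter-∷⁻ x xs = trans (sym (perimeter-∷ x xs))

perimeter-[_] : ∀ x → perimeter (x ∷ []) ≡ x
perimeter-[ x ] = trans (perimeter-∷ x []) (+-identityʳ x)

distinct : ∀ {M} x xs → All (_≥ 1) (x ∷ xs) → Linked _>_ (x ∷ xs) → x + length xs ≡ M →
           DistinctWithPerimeter M
distinct x xs pos dec e = x ∷ xs , ((pos , Linked.map <⇒≤ dec) , dec) , trans (perimeter-∷ x xs) e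

odd : ∀ {M} x xs → Linked _≥_ (x ∷ xs) → All Odd (x ∷ xs) → x + length xs ≡ M →
      OddWithPerimeter M
odd x xs dec odds e =
  x ∷ xs , ((All.map odd⇒positive odds , dec) , odds) , trans (perimeter-∷ x xs) e

perimeter≡1 : ∀ {l} → All (_≥ 1) l → perimeter l ≡ 1 → l ≡ 1 ∷ []
perimeter≡1 {[]}     _   ()
perimeter≡1 {x ∷ xs} pos pe = go x xs pos (perimeter-∷⁻ x xs pe)
  where
  go : ∀ x xs → All (_≥ 1) (x ∷ xs) → x + length xs ≡ 1 → x ∷ xs ≡ 1 ∷ []
  go zero          _       (() ∷ _) _
  go (suc zero)    []      _        _  = refl
  go (suc zero)    (_ ∷ _) _        ()
  go (suc (suc _)) _       _        ()

perimeter≡2 : ∀ {l} → IsPartition l → perimeter l ≡ 2 → l ≡ 2 ∷ [] ⊎ l ≡ 1 ∷ 1 ∷ []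
perimeter≡2 {[]}     _   ()
perimeter≡2 {x ∷ xs} p pe = go x xs p (perimeter-∷⁻ x xs pe)
  where
  go : ∀ x xs → IsPartition (x ∷ xs) → x + length xs ≡ 2 → x ∷ xs ≡ 2 ∷ [] ⊎ x ∷ xs ≡ 1 ∷ 1 ∷ []
  go zero                _                   (() ∷ _ , _)         _
  go (suc zero)          []                  _                    ()
  go (suc zero)          (zero ∷ [])         (_ ∷ () ∷ _ , _)     _
  go (suc zero)          (suc zero ∷ [])     _                    _  = inj₂ refl
  go (suc zero)          (suc (suc _) ∷ [])  (_ , s≤s () ∷ _)     _
  go (suc zero)          (_ ∷ _ ∷ _)         _                    ()
  go (suc (suc zero))    []                  _                    _  = inj₁ refl
  go (suc (suc zero))    (_ ∷ _)             _                    ()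
  go (suc (suc (suc _))) _                   _                    ()

distinct-perimeter≡2 : ∀ {l} → IsDistinctPartition l → perimeter l ≡ 2 → l ≡ 2 ∷ []
distinct-perimeter≡2 (p , _) pe with perimeter≡2 p pe
... | inj₁ l≡[2] = l≡[2]
distinct-perimeter≡2 (_ , s≤s () ∷ _) _ | inj₂ refl

odd-perimeter≡2 : ∀ {l} → IsOddPartition l → perimeter l ≡ 2 → l ≡ 1 ∷ 1 ∷ []
odd-perimeter≡2 (p , _) pe with perimeter≡2 p pe
... | inj₂ l≡[1,1] = l≡[1,1]
odd-perimeter≡2 (_ , () ∷ _) _ | inj₁ refl

distinct-1 : HasCard (DistinctWithPerimeter 1) 1
distinct-1 = HasCard-1 (distinct 1 [] (s≤s z≤n ∷ []) [-] refl)
  λ (l , ((pos , _) , _) , pe) → DistinctWithPerimeter-≡ (sym (perimeter≡1 pos pe))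

distinct-2 : HasCard (DistinctWithPerimeter 2) 1
distinct-2 = HasCard-1 (distinct 2 [] (s≤s z≤n ∷ []) [-] refl)
  λ (l , d , pe) → DistinctWithPerimeter-≡ (sym (distinct-perimeter≡2 d pe))

odd-1 : HasCard (OddWithPerimeter 1) 1
odd-1 = HasCard-1 (odd 1 [] [-] (refl ∷ []) refl)
  λ (l , ((pos , _) , _) , pe) → OddWithPerimeter-≡ (sym (perimeter≡1 pos pe))

odd-2 : HasCard (OddWithPerimeter 2) 1
odd-2 = HasCard-1 (odd 1 (1 ∷ []) (≤-refl ∷ [-]) (refl ∷ refl ∷ []) refl)
  λ (l , o , pe) → OddWithPerimeter-≡ (sym (odd-perimeter≡2 o pe))

module DistinctRecurrence (m : ℕ) where

  raiseHead : DistinctWithPerimeter (2 + m) → DistinctWithPerimeter (3 + m)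
  raiseHead ([] , _ , ())
  raiseHead (x ∷ xs , ((_ ∷ pos , _) , dec) , pe) =
    distinct (suc x) xs (s≤s z≤n ∷ pos) (Linked-replaceHead m<n⇒m<1+n dec)
             (cong suc (perimeter-∷⁻ x xs pe))

  prependSuc : DistinctWithPerimeter (1 + m) → DistinctWithPerimeter (3 + m)
  prependSuc ([] , _ , ())
  prependSuc (y ∷ ys , ((pos , _) , dec) , pe) =
    distinct (suc y) (y ∷ ys) (s≤s z≤n ∷ pos) (≤-refl ∷ dec)
             (cong suc (trans (+-suc y (length ys)) (cong suc (perimeter-∷⁻ y ys pe))))

  join : DistinctWithPerimeter (2 + m) ⊎ DistinctWithPerimeter (1 + m) →
         DistinctWithPerimeter (3 + m)
  join = [ raiseHead , prependSuc ]

  split : DistinctWithPerimeter (3 + m) →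
          DistinctWithPerimeter (2 + m) ⊎ DistinctWithPerimeter (1 + m)
  split ([] , _ , ())
  split (zero ∷ _ , ((() ∷ _ , _) , _) , _)
  split (suc x ∷ [] , _ , pe) =
    inj₁ (distinct x [] (≤-trans (s≤s z≤n) (≤-reflexive (sym x≡2+m)) ∷ []) [-]
                   (trans (+-identityʳ x) x≡2+m))
    where
    x≡2+m : x ≡ 2 + m
    x≡2+m = suc-injective (trans (sym perimeter-[ suc x ]) pe)
  split (suc x ∷ y ∷ ys , ((_ ∷ pos , _) , y<1+x ∷ dec) , pe) with x ≟ y
  ... | yes refl = inj₂ (distinct y ys pos dec
          (suc-injective (trans (sym (+-suc y (length ys)))
                                (suc-injective (perimeter-∷⁻ (suc y) (y ∷ ys) pe)))))
  ... | no x≢y   = inj₁ (distinct x (y ∷ ys) (≤-trans (All.head pos) y≤x ∷ pos)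
                                  (≤∧≢⇒< y≤x (x≢y ∘ sym) ∷ dec)
                                  (suc-injective (perimeter-∷⁻ (suc x) (y ∷ ys) pe)))
    where
    y≤x : y ≤ x
    y≤x = ≤-pred y<1+x

  join-split : ∀ d → join (split d) ≡ d
  join-split ([] , _ , ())
  join-split (zero ∷ _ , ((() ∷ _ , _) , _) , _)
  join-split (suc x ∷ [] , _) = DistinctWithPerimeter-≡ refl
  join-split (suc x ∷ y ∷ ys , ((_ ∷ _ ∷ _ , _) , _ ∷ _) , _) with x ≟ y
  ... | yes refl = DistinctWithPerimeter-≡ refl
  ... | no _     = DistinctWithPerimeter-≡ refl

  split-join : ∀ d → split (join d) ≡ d
  split-join (inj₁ ([] , _ , ()))
  split-join (inj₁ (x ∷ [] , ((_ ∷ _ , _) , _) , _)) = cong inj₁ (DistinctWithPerimeter-≡ refl)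
  split-join (inj₁ (x ∷ y ∷ ys , ((_ ∷ _ ∷ _ , _) , y<x ∷ _) , _)) with x ≟ y
  ... | yes refl = ⊥-elim (<-irrefl refl y<x)
  ... | no _     = cong inj₁ (DistinctWithPerimeter-≡ refl)
  split-join (inj₂ ([] , _ , ()))
  split-join (inj₂ (y ∷ ys , ((_ ∷ _ , _) , _) , _)) with y ≟ y
  ... | yes refl = cong inj₂ (DistinctWithPerimeter-≡ refl)
  ... | no y≢y   = ⊥-elim (y≢y refl)

  recurrence : (DistinctWithPerimeter (2 + m) ⊎ DistinctWithPerimeter (1 + m)) ↔
               DistinctWithPerimeter (3 + m)
  recurrence = mk↔ₛ′ join split join-split split-join

∸-+-cancel : ∀ {x n o k} → o ≤ x → x + n ≡ o + k → (x ∸ o) + n ≡ k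
∸-+-cancel {x} {n} {o} {k} o≤x e =
  trans (sym (+-∸-comm n o≤x)) (trans (cong (_∸ o) e) (m+n∸m≡n o k))

module OddRecurrence (m : ℕ) where

  duplicateHead : OddWithPerimeter (2 + m) → OddWithPerimeter (3 + m)
  duplicateHead ([] , _ , ())
  duplicateHead (y ∷ ys , ((_ , dec) , odds@(oy ∷ _)) , pe) =
    odd y (y ∷ ys) (≤-refl ∷ dec) (oy ∷ odds)
        (trans (+-suc y (length ys)) (cong suc (perimeter-∷⁻ y ys pe)))

  raiseHeadBy2 : OddWithPerimeter (1 + m) → OddWithPerimeter (3 + m)
  raiseHeadBy2 ([] , _ , ())
  raiseHeadBy2 (z ∷ zs , ((_ , dec) , oz ∷ odds) , pe) =
    odd (2 + z) zs (Linked-replaceHead (λ w≤z → ≤-trans w≤z (m≤n+m z 2)) dec)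
        (trans (%2-suc-suc z) oz ∷ odds) (cong (2 +_) (perimeter-∷⁻ z zs pe))

  join : OddWithPerimeter (2 + m) ⊎ OddWithPerimeter (1 + m) → OddWithPerimeter (3 + m)
  join = [ duplicateHead , raiseHeadBy2 ]

  2≤singleton : ∀ x → perimeter (x ∷ []) ≡ 3 + m → 2 ≤ x
  2≤singleton x pe = ≤-trans (m≤m+n 2 (1 + m)) (≤-reflexive (trans (sym pe) perimeter-[ x ]))

  2+y≤x : ∀ {x y} → y ≤ x → x ≢ y → Odd x → Odd y → 2 + y ≤ x
  2+y≤x y≤x x≢y ox oy = odd-gap ox oy (≤∧≢⇒< y≤x (x≢y ∘ sym))

  split : OddWithPerimeter (3 + m) → OddWithPerimeter (2 + m) ⊎ OddWithPerimeter (1 + m)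
  split ([] , _ , ())
  split (x ∷ [] , (_ , ox ∷ []) , pe) =
    inj₂ (odd (x ∸ 2) [] [-] (odd-∸2 (2≤singleton x pe) ox ∷ [])
              (∸-+-cancel (2≤singleton x pe) (perimeter-∷⁻ x [] pe)))
  split (x ∷ y ∷ ys , ((_ , y≤x ∷ dec) , ox ∷ odds@(oy ∷ _)) , pe) with x ≟ y
  ... | yes refl = inj₁ (odd x ys dec odds
          (suc-injective (trans (sym (+-suc x (length ys))) (perimeter-∷⁻ x (x ∷ ys) pe))))
  ... | no x≢y   = inj₂ (odd (x ∸ 2) (y ∷ ys) (∸-monoˡ-≤ 2 gap ∷ dec) (odd-∸2 2≤x ox ∷ odds)
                             (∸-+-cancel 2≤x (perimeter-∷⁻ x (y ∷ ys) pe)))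
    where
    gap : 2 + y ≤ x
    gap = 2+y≤x y≤x x≢y ox oy
    2≤x : 2 ≤ x
    2≤x = ≤-trans (m≤m+n 2 y) gap

  join-split : ∀ o → join (split o) ≡ o
  join-split ([] , _ , ())
  join-split (x ∷ [] , (_ , _ ∷ []) , pe) =
    OddWithPerimeter-≡ (cong (_∷ []) (m+[n∸m]≡n (2≤singleton x pe)))
  join-split (x ∷ y ∷ ys , ((_ , y≤x ∷ _) , ox ∷ oy ∷ _) , _) with x ≟ y
  ... | yes refl = OddWithPerimeter-≡ refl
  ... | no x≢y   = OddWithPerimeter-≡
          (cong (_∷ y ∷ ys) (m+[n∸m]≡n (≤-trans (m≤m+n 2 y) (2+y≤x y≤x x≢y ox oy))))

  split-join : ∀ o → split (join o) ≡ o
  split-join (inj₁ ([] , _ , ()))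
  split-join (inj₁ (y ∷ ys , ((_ , _) , _ ∷ _) , _)) with y ≟ y
  ... | yes refl = cong inj₁ (OddWithPerimeter-≡ refl)
  ... | no y≢y   = ⊥-elim (y≢y refl)
  split-join (inj₂ ([] , _ , ()))
  split-join (inj₂ (z ∷ [] , (_ , _ ∷ []) , _)) = cong inj₂ (OddWithPerimeter-≡ refl)
  split-join (inj₂ (z ∷ w ∷ ws , ((_ , w≤z ∷ _) , _ ∷ _ ∷ _) , _)) with 2 + z ≟ w
  ... | yes refl = ⊥-elim (<-irrefl refl (≤-trans (n≤1+n (suc z)) w≤z))
  ... | no _     = cong inj₂ (OddWithPerimeter-≡ refl)

  recurrence : (OddWithPerimeter (2 + m) ⊎ OddWithPerimeter (1 + m)) ↔ OddWithPerimeter (3 + m)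
  recurrence = mk↔ₛ′ join split join-split split-join

theorem4 : (M : ℕ) → M ≥ 1 →
    Σ ℕ (λ d → Σ ℕ (λ o →
    HasCard (DistinctWithPerimeter M) d × HasCard (OddWithPerimeter M) o
    × d ≡ o × o ≡ fib M))
theorem4 (suc m) _ =
  fib (suc m) , fib (suc m) ,
  HasCard-fib DistinctWithPerimeter distinct-1 distinct-2 DistinctRecurrence.recurrence m ,
  HasCard-fib OddWithPerimeter odd-1 odd-2 OddRecurrence.recurrence m ,
  refl , refl
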